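{- There is a bipartite graph $G$ with no induced cycle $C_k$ for $k>6$ such that $|V(\mathcal{H}(G))|\ge 2^{n/2}-2$, where $n=|V(G)|$.
   Context: A graph is Helly if every family of pairwise intersecting disks $D(v,r)=\{u:d(u,v)\le r\}$ (shortest-path metric) has a common vertex. The injective hull $\mathcal{H}(G)$ of a connected graph $G$ is the unique minimal Helly graph containing $G$ as an isometric subgraph (equivalently, the graph on functions $f:V(G)\to\mathbb{Z}_{\ge0}$ with $f(x)+f(y)\ge d_G(x,y)$ for all $x,y$ and for each $x$ some $y$ with equality, adjacency meaning sup-norm distance 1). -}

module Defs where

open import Data.Nat using (ℕ; zero; suc; _+_; _≤_; _<_)
open import Data.Fin using (Fin; toℕ)
open import Data.Bool using (Bool)
open import Data.Product using (Σ; ∃; ∃-syntax; _×_; _,_)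
open import Data.Sum using (_⊎_)
open import Relation.Nullary using (¬_)
open import Relation.Binary.PropositionalEquality using (_≡_; _≢_)


record Graph (n : ℕ) : Set₁ where
  field
    Adj    : Fin n → Fin n → Set
    sym    : ∀ {u v} → Adj u v → Adj v u
    irrefl : ∀ {u} → ¬ Adj u u
open Graph public

data Walk {n : ℕ} (G : Graph n) : Fin n → Fin n → ℕ → Set where
  here : ∀ {u} → Walk G u u 0
  step : ∀ {u w v k} → Adj G u w → Walk G w v k → Walk G u v (suc k)

Dist : ∀ {n} → Graph n → Fin n → Fin n → ℕ → Set
Dist G u v k = Walk G u v k × (∀ j → Walk G u v j → k ≤ j)

Connected : ∀ {n} → Graph n → Set
Connected G = ∀ u v → ∃[ k ] Walk G u v k

Bipartite : ∀ {n} → Graph n → Set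
Bipartite {n} G = Σ (Fin n → Bool) λ c → ∀ {u v : Fin n} → Adj G u v → c u ≢ c v

CycAdj : (k : ℕ) → Fin k → Fin k → Set
CycAdj k i j = Succ i j ⊎ Succ j i
  where
    Succ : Fin k → Fin k → Set
    Succ a b = (suc (toℕ a) ≡ toℕ b) ⊎ ((suc (toℕ a) ≡ k) × (toℕ b ≡ 0))

HasInducedCycle : ∀ {n} → Graph n → ℕ → Set
HasInducedCycle {n} G k =
  Σ (Fin k → Fin n) λ φ →
    (∀ i j → φ i ≡ φ j → i ≡ j) ×
    (∀ i j → (Adj G (φ i) (φ j) → CycAdj k i j) × (CycAdj k i j → Adj G (φ i) (φ j)))

-- Vertices of the injective hull H(G): functions f : V(G) → ℕ with
-- f(x)+f(y) ≥ d(x,y) for all x,y, and for each x some y with equality.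
IsHullVertex : ∀ {n} → Graph n → (Fin n → ℕ) → Set
IsHullVertex {n} G f =
  (∀ x y k → Dist G x y k → k ≤ f x + f y) ×
  (∀ x → ∃[ y ] ∃[ k ] (Dist G x y k × f x + f y ≡ k))

HullSizeAtLeast : ∀ {n} → Graph n → ℕ → Set
HullSizeAtLeast {n} G N =
  Σ (Fin N → (Fin n → ℕ)) λ F →
    (∀ i → IsHullVertex G (F i)) ×
    (∀ i j → i ≢ j → ∃[ x ] F i x ≢ F j x)

module Submission where

-- For m ≥ 3 the witness is the crown graph: K_{m,m} minus a perfect matching.
-- Every vertex x has exactly one "partner" at distance 3 (its matched vertex)
-- and is within distance 2 of everything else.  Two general facts do the work:
--   * in such a graph every f ≥ 1 with f x + f (partner x) = 3 is a hull vertex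
--     (pairedHullVertex); choosing f ∈ {1,2} freely on one side, and
--     complementarily on the other, gives 2^m distinct hull vertices;
--   * a properly 2-coloured graph in which each vertex has at most one
--     non-neighbour in the other colour class has no induced cycle C_k, k ≥ 7
--     (noLongInducedCycle), since C_k would give two such non-neighbours.
-- For m ∈ {1,2} the bound is at most 2; the star K_{1,2m-1} serves, its hull
-- containing the two distance functions to two distinct vertices
-- (distanceIsHullVertex).

open import Defs
open import Data.Nat using (ℕ; _+_; _^_; _∸_; _≤_; _<_)
open import Relation.Nullary using (¬_)
open import Data.Product using (Σ; _×_)

open import Data.Nat using (zero; suc; z≤n; s≤s)
open import Data.Nat.Properties
  using (≤-trans; ≤-reflexive; +-mono-≤; +-suc; +-identityʳ; n≤0⇒n≡0; m∸n≤m)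
open import Data.Fin using (Fin; toℕ; #_; splitAt; join; inject≤; finToFun; funToFin; combine)
  renaming (zero to fzero; suc to fsuc; _≟_ to _≟ᶠ_)
open import Data.Fin.Properties
  using (splitAt-join; join-splitAt; inject≤-injective; funToFin-finToFin; ¬∀⟶∃¬)
open import Data.Bool using (Bool; true; false; not)
open import Data.Bool.Properties using (not-¬; ¬-not) renaming (_≟_ to _≟ᵇ_)
open import Data.Sum using (inj₁; inj₂; [_,_]′)
open import Data.Product using (_,_; proj₁; proj₂; ∃-syntax)
open import Data.Empty using (⊥-elim)
open import Function using (id; const; _∘_)
open import Relation.Nullary using (yes; no)
open import Relation.Binary.PropositionalEquality as ≡
  using (_≡_; _≢_; refl; trans; cong; cong₂; subst; ≢-sym)

Witness : ∀ {n} → Graph n → ℕ → Set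
Witness G N =
  Connected G × Bipartite G × (∀ k → 6 < k → ¬ HasInducedCycle G k) × HullSizeAtLeast G N

module _ {n : ℕ} {G : Graph n} where

  _++ʷ_ : ∀ {u v w j k} → Walk G u v j → Walk G v w k → Walk G u w (j + k)
  here     ++ʷ q = q
  step e p ++ʷ q = step e (p ++ʷ q)

  reverseOnto : ∀ {u v w} j {k} → Walk G u v j → Walk G u w k → Walk G v w (j + k)
  reverseOnto .0       here       acc = acc
  reverseOnto (suc j) {k} (step e p) acc =
    subst (Walk G _ _) (+-suc j k) (reverseOnto j p (step (sym G e) acc))

  reverse : ∀ {u v j} → Walk G u v j → Walk G v u j
  reverse {j = j} p = subst (Walk G _ _) (+-identityʳ j) (reverseOnto j p here)

  walk₀-trivial : ∀ {u v} → Walk G u v 0 → u ≡ v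
  walk₀-trivial here = refl

  dist-self : ∀ {v k} → Dist G v v k → k ≡ 0
  dist-self (_ , minimal) = n≤0⇒n≡0 (minimal 0 here)

  -- The distance function δ = d(·,v) to a fixed vertex v lies in the injective
  -- hull: the triangle inequality through v gives δ x + δ y ≥ d(x,y), and the
  -- pair (x,v) attains equality.
  distanceIsHullVertex : (v : Fin n) (δ : Fin n → ℕ) →
                         (∀ x → Dist G x v (δ x)) → IsHullVertex G δ
  distanceIsHullVertex v δ dist = triangle , tight
    where
    triangle : ∀ x y k → Dist G x y k → k ≤ δ x + δ y
    triangle x y k (_ , minimal) =
      minimal _ (proj₁ (dist x) ++ʷ reverse (proj₁ (dist y)))
    tight : ∀ x → ∃[ y ] ∃[ k ] (Dist G x y k × δ x + δ y ≡ k)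
    tight x = v , δ x , dist x , trans (cong (δ x +_) (dist-self (dist v))) (+-identityʳ (δ x))

  twoDistancesHullSize : ∀ {u v} (δᵤ δᵥ : Fin n → ℕ) → u ≢ v →
                         (∀ x → Dist G x u (δᵤ x)) → (∀ x → Dist G x v (δᵥ x)) →
                         HullSizeAtLeast G 2
  twoDistancesHullSize {u} {v} δᵤ δᵥ u≢v distᵤ distᵥ = F , hull , distinct
    where
    F : Fin 2 → Fin n → ℕ
    F fzero    = δᵤ
    F (fsuc _) = δᵥ
    hull : ∀ i → IsHullVertex G (F i)
    hull fzero    = distanceIsHullVertex u δᵤ distᵤ
    hull (fsuc _) = distanceIsHullVertex v δᵥ distᵥ
    differAtU : δᵤ u ≢ δᵥ u
    differAtU e = u≢v (walk₀-trivial (subst (Walk G u v) δᵥu≡0 (proj₁ (distᵥ u))))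
      where
      δᵥu≡0 : δᵥ u ≡ 0
      δᵥu≡0 = trans (≡.sym e) (dist-self (distᵤ u))
    distinct : ∀ i j → i ≢ j → ∃[ x ] F i x ≢ F j x
    distinct fzero           fzero           i≢j = ⊥-elim (i≢j refl)
    distinct fzero           (fsuc fzero)    _   = u , differAtU
    distinct (fsuc fzero)    fzero           _   = u , differAtU ∘ ≡.sym
    distinct (fsuc fzero)    (fsuc fzero)    i≢j = ⊥-elim (i≢j refl)

  hullSize-weaken : ∀ {N N′} → N′ ≤ N → HullSizeAtLeast G N → HullSizeAtLeast G N′
  hullSize-weaken N′≤N (F , hull , distinct) =
    F ∘ embed , hull ∘ embed ,
    λ i j i≢j → distinct (embed i) (embed j) (i≢j ∘ inject≤-injective N′≤N N′≤N i j)
    where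
    embed : Fin _ → Fin _
    embed i = inject≤ i N′≤N

  -- Let every vertex x have a partner at distance exactly 3, all other
  -- vertices lying within distance 2 of x.  Then every f ≥ 1 with
  -- f x + f (partner x) = 3 is a hull vertex: pairs other than partners
  -- satisfy the triangle condition because 2 ≤ f x + f y, partners with equality.
  pairedHullVertex : (partner : Fin n → Fin n) →
                     (∀ x y → y ≢ partner x → ∃[ j ] (j ≤ 2 × Walk G x y j)) →
                     (∀ x → Dist G x (partner x) 3) →
                     (f : Fin n → ℕ) → (∀ x → 1 ≤ f x) → (∀ x → f x + f (partner x) ≡ 3) →
                     IsHullVertex G f
  pairedHullVertex partner near far f f≥1 f-sum = triangle , λ x → partner x , 3 , far x , f-sum x
    where
    triangle : ∀ x y k → Dist G x y k → k ≤ f x + f y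
    triangle x y k (_ , minimal) with y ≟ᶠ partner x
    ... | yes refl = ≤-trans (minimal 3 (proj₁ (far x))) (≤-reflexive (≡.sym (f-sum x)))
    ... | no y≢x′  =
      let (j , j≤2 , w) = near x y y≢x′
      in ≤-trans (minimal j w) (≤-trans j≤2 (+-mono-≤ (f≥1 x) (f≥1 y)))

witness-weaken : ∀ {n} {G : Graph n} {N N′} → N′ ≤ N → Witness G N → Witness G N′
witness-weaken N′≤N (conn , bip , noCycle , hull) = conn , bip , noCycle , hullSize-weaken N′≤N hull

-- funToFin respects pointwise equality (there is no function extensionality).
funToFin-cong : ∀ {a b} (s t : Fin a → Fin b) → (∀ i → s i ≡ t i) → funToFin s ≡ funToFin t
funToFin-cong {zero}  s t s≗t = refl
funToFin-cong {suc a} s t s≗t =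
  cong₂ combine (s≗t fzero) (funToFin-cong (s ∘ fsuc) (t ∘ fsuc) (s≗t ∘ fsuc))

finToFun-injective : ∀ {a b} (i j : Fin (b ^ a)) →
                     (∀ k → finToFun {b} {a} i k ≡ finToFun j k) → i ≡ j
finToFun-injective {a} {b} i j i≗j = begin
  i                                 ≡⟨ ≡.sym (funToFin-finToFin {a} {b} i) ⟩
  funToFin {a} {b} (finToFun i)     ≡⟨ funToFin-cong (finToFun i) (finToFun j) i≗j ⟩
  funToFin {a} {b} (finToFun j)     ≡⟨ funToFin-finToFin {a} {b} j ⟩
  j                                 ∎
  where open ≡.≡-Reasoning

hullSizeFromCodes : ∀ {n a b} {G : Graph n} (h : (Fin a → Fin b) → Fin n → ℕ) →
                    (∀ s → IsHullVertex G (h s)) →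
                    (∀ s t k → s k ≢ t k → ∃[ x ] h s x ≢ h t x) →
                    HullSizeAtLeast G (b ^ a)
hullSizeFromCodes {a = a} {b} h hull separate =
  h ∘ decode , hull ∘ decode , λ i j i≢j →
    let (k , differ) = ¬∀⟶∃¬ a _ (λ k → decode i k ≟ᶠ decode j k)
                             (i≢j ∘ finToFun-injective i j)
    in separate _ _ k differ
  where
  decode : Fin (b ^ a) → Fin a → Fin b
  decode = finToFun

AlmostCompleteBipartite : ∀ {n} → Graph n → (Fin n → Bool) → Set
AlmostCompleteBipartite {n} G col =
  ∀ {p q r : Fin n} → col p ≢ col q → col p ≢ col r → ¬ Adj G p q → ¬ Adj G p r → q ≡ r

module _ {n : ℕ} (G : Graph n) (col : Fin n → Bool)
         (proper : ∀ {u v} → Adj G u v → col u ≢ col v) where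

  twoStepSameColour : ∀ {u v w} → Adj G u v → Adj G v w → col u ≡ col w
  twoStepSameColour u~v v~w = trans (¬-not (proper u~v)) (≡.sym (¬-not (≢-sym (proper v~w))))

  -- An induced C_k, k ≥ 7, in such a graph is impossible: its vertices 3 and 5
  -- are distinct, both of the colour opposite to vertex 0 and both non-adjacent to it.
  noLongInducedCycle : AlmostCompleteBipartite G col → ∀ k → 6 < k → ¬ HasInducedCycle G k
  noLongInducedCycle almost (suc (suc (suc (suc (suc (suc (suc k)))))))
                     (s≤s (s≤s (s≤s (s≤s (s≤s (s≤s (s≤s z≤n))))))) (φ , φ-inj , induced) =
    3≢5 (φ-inj (# 3) (# 5) (almost colour₀≢colour₃ colour₀≢colour₅ (chord 0≁3) (chord 0≁5)))
    where
    chord : ∀ {i j : Fin (7 + k)} → ¬ CycAdj (7 + k) i j → ¬ Adj G (φ i) (φ j)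
    chord {i} {j} i≁j = i≁j ∘ proj₁ (induced i j)
    edge : ∀ (i : Fin (7 + k)) j → suc (toℕ i) ≡ toℕ j → Adj G (φ i) (φ j)
    edge i j e = proj₂ (induced i j) (inj₁ (inj₁ e))
    colour₀≡colour₂ : col (φ (# 0)) ≡ col (φ (# 2))
    colour₀≡colour₂ = twoStepSameColour (edge (# 0) (# 1) refl) (edge (# 1) (# 2) refl)
    colour₀≡colour₄ : col (φ (# 0)) ≡ col (φ (# 4))
    colour₀≡colour₄ = trans colour₀≡colour₂
                        (twoStepSameColour (edge (# 2) (# 3) refl) (edge (# 3) (# 4) refl))
    colour₀≢colour₃ : col (φ (# 0)) ≢ col (φ (# 3))
    colour₀≢colour₃ = proper (edge (# 2) (# 3) refl) ∘ trans (≡.sym colour₀≡colour₂)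
    colour₀≢colour₅ : col (φ (# 0)) ≢ col (φ (# 5))
    colour₀≢colour₅ = proper (edge (# 4) (# 5) refl) ∘ trans (≡.sym colour₀≡colour₄)
    0≁3 : ¬ CycAdj (7 + k) (# 0) (# 3)
    0≁3 (inj₁ (inj₁ ()))
    0≁3 (inj₁ (inj₂ (_ , ())))
    0≁3 (inj₂ (inj₁ ()))
    0≁3 (inj₂ (inj₂ (() , _)))
    0≁5 : ¬ CycAdj (7 + k) (# 0) (# 5)
    0≁5 (inj₁ (inj₁ ()))
    0≁5 (inj₁ (inj₂ (_ , ())))
    0≁5 (inj₂ (inj₁ ()))
    0≁5 (inj₂ (inj₂ (() , _)))
    3≢5 : # 3 ≢ # 5
    3≢5 ()

isCentre : ∀ {n} → Fin n → Bool
isCentre fzero    = true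
isCentre (fsuc _) = false

Star : ∀ n → Graph n
Star n = record
  { Adj    = λ u v → isCentre u ≢ isCentre v
  ; sym    = ≢-sym
  ; irrefl = λ u≁u → u≁u refl
  }

module StarGraph (n : ℕ) where

  G : Graph (suc (suc n))
  G = Star (suc (suc n))

  -- Distances to the centre and to the leaf 1; a leaf reaches another leaf
  -- only through the centre.
  δcentre δleaf : Fin (suc (suc n)) → ℕ
  δcentre fzero    = 0
  δcentre (fsuc _) = 1
  δleaf fzero           = 1
  δleaf (fsuc fzero)    = 0
  δleaf (fsuc (fsuc _)) = 2

  distToCentre : ∀ x → Dist G x fzero (δcentre x)
  distToCentre fzero    = here , λ _ _ → z≤n
  distToCentre (fsuc _) = step (λ ()) here , λ { _ (step _ _) → s≤s z≤n }

  distToLeaf : ∀ x → Dist G x (fsuc fzero) (δleaf x)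
  distToLeaf fzero           = step (λ ()) here , λ { _ (step _ _) → s≤s z≤n }
  distToLeaf (fsuc fzero)    = here , λ _ _ → z≤n
  distToLeaf (fsuc (fsuc _)) =
    step {w = fzero} (λ ()) (step (λ ()) here) ,
    λ { _ (step leaf~leaf here) → ⊥-elim (leaf~leaf refl)
      ; _ (step _ (step _ _))   → s≤s (s≤s z≤n) }

  connected : Connected G
  connected u v = _ , (proj₁ (distToCentre u) ++ʷ reverse (proj₁ (distToCentre v)))

  -- Colouring by isCentre, the star is complete bipartite.
  witness : Witness G 2
  witness =
    connected ,
    (isCentre , id) ,
    noLongInducedCycle G isCentre id (λ p≢q _ p≁q _ → ⊥-elim (p≁q p≢q)) ,
    twoDistancesHullSize δcentre δleaf (λ ()) distToCentre distToLeaf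

avoidTwo : ∀ n (i j : Fin (suc (suc (suc n)))) → ∃[ k ] (k ≢ i × k ≢ j)
avoidTwo n fzero           fzero           = # 1 , (λ ()) , (λ ())
avoidTwo n fzero           (fsuc fzero)    = # 2 , (λ ()) , (λ ())
avoidTwo n fzero           (fsuc (fsuc _)) = # 1 , (λ ()) , (λ ())
avoidTwo n (fsuc fzero)    fzero           = # 2 , (λ ()) , (λ ())
avoidTwo n (fsuc fzero)    (fsuc _)        = # 0 , (λ ()) , (λ ())
avoidTwo n (fsuc (fsuc _)) fzero           = # 1 , (λ ()) , (λ ())
avoidTwo n (fsuc (fsuc _)) (fsuc _)        = # 0 , (λ ()) , (λ ())

-- The crown graph on sides true/false, each a copy of Fin m: vertices on
-- opposite sides are adjacent iff their indices differ.  It is assumed that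
-- any two indices can be avoided by a third (i.e. m ≥ 3).
module Crown (m : ℕ) (avoid : ∀ (i j : Fin m) → ∃[ k ] (k ≢ i × k ≢ j)) where

  V : Set
  V = Fin (m + m)

  side : V → Bool
  side u = [ const true , const false ]′ (splitAt m u)

  idx : V → Fin m
  idx u = [ id , id ]′ (splitAt m u)

  vertex : Bool → Fin m → V
  vertex true  i = join m m (inj₁ i)
  vertex false i = join m m (inj₂ i)

  side-vertex : ∀ c i → side (vertex c i) ≡ c
  side-vertex true  i rewrite splitAt-join m m (inj₁ i) = refl
  side-vertex false i rewrite splitAt-join m m (inj₂ i) = refl

  idx-vertex : ∀ c i → idx (vertex c i) ≡ i
  idx-vertex true  i rewrite splitAt-join m m (inj₁ i) = refl
  idx-vertex false i rewrite splitAt-join m m (inj₂ i) = refl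

  vertex-side-idx : ∀ u → vertex (side u) (idx u) ≡ u
  vertex-side-idx u with splitAt m u | join-splitAt m m u
  ... | inj₁ _ | e = e
  ... | inj₂ _ | e = e

  vertex-ext : ∀ {u v} → side u ≡ side v → idx u ≡ idx v → u ≡ v
  vertex-ext {u} {v} s i =
    trans (≡.sym (vertex-side-idx u)) (trans (cong₂ vertex s i) (vertex-side-idx v))

  G : Graph (m + m)
  G = record
    { Adj    = λ u v → side u ≢ side v × idx u ≢ idx v
    ; sym    = λ (s , i) → ≢-sym s , ≢-sym i
    ; irrefl = λ (s , _) → s refl
    }

  toward : ∀ {x} c k → side x ≢ c → idx x ≢ k → Adj G x (vertex c k)
  toward c k s i = s ∘ (λ e → trans e (side-vertex c k)) , i ∘ (λ e → trans e (idx-vertex c k))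

  partner : V → V
  partner x = vertex (not (side x)) (idx x)

  side-partner : ∀ x → side (partner x) ≡ not (side x)
  side-partner x = side-vertex (not (side x)) (idx x)

  idx-partner : ∀ x → idx (partner x) ≡ idx x
  idx-partner x = idx-vertex (not (side x)) (idx x)

  isPartner : ∀ {x y} → side x ≢ side y → idx x ≡ idx y → y ≡ partner x
  isPartner {x} s i =
    vertex-ext (trans (¬-not (≢-sym s)) (≡.sym (side-partner x)))
               (trans (≡.sym i) (≡.sym (idx-partner x)))

  nonNeighbourIsPartner : ∀ {x y} → side x ≢ side y → ¬ Adj G x y → y ≡ partner x
  nonNeighbourIsPartner {x} {y} s x≁y with idx x ≟ᶠ idx y
  ... | yes i = isPartner s i
  ... | no i  = ⊥-elim (x≁y (s , i))

  almostComplete : AlmostCompleteBipartite G side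
  almostComplete p≢q p≢r p≁q p≁r =
    trans (nonNeighbourIsPartner p≢q p≁q) (≡.sym (nonNeighbourIsPartner p≢r p≁r))

  sameSideWalk : ∀ {x y} → side x ≡ side y → Walk G x y 2
  sameSideWalk {x} {y} s =
    let (k , k≢x , k≢y) = avoid (idx x) (idx y)
    in step (toward (not (side x)) k (not-¬ refl) (≢-sym k≢x))
            (step (sym G (toward (not (side x)) k (not-¬ (≡.sym s)) (≢-sym k≢y))) here)

  -- Vertices with the same index on opposite sides are not within distance 2:
  -- a walk of length 2 returns to the same side.
  notWithinTwo : ∀ {x y} → side x ≢ side y → idx x ≡ idx y → ∀ j → Walk G x y j → 3 ≤ j
  notWithinTwo s _ .0 here = ⊥-elim (s refl)
  notWithinTwo _ i .1 (step (_ , i≢) here) = ⊥-elim (i≢ i)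
  notWithinTwo s _ .2 (step (s₁ , _) (step (s₂ , _) here)) =
    ⊥-elim (s (trans (¬-not s₁) (≡.sym (¬-not (≢-sym s₂)))))
  notWithinTwo _ _ .(suc (suc (suc _))) (step _ (step _ (step _ _))) = s≤s (s≤s (s≤s z≤n))

  near : ∀ x y → y ≢ partner x → ∃[ j ] (j ≤ 2 × Walk G x y j)
  near x y y≢x′ with side x ≟ᵇ side y | idx x ≟ᶠ idx y
  ... | yes s | yes i = 0 , z≤n , subst (λ z → Walk G x z 0) (vertex-ext s i) here
  ... | yes s | no _  = 2 , s≤s (s≤s z≤n) , sameSideWalk s
  ... | no s  | no i  = 1 , s≤s z≤n , step (s , i) here
  ... | no s  | yes i = ⊥-elim (y≢x′ (isPartner s i))

  -- The partner is at distance exactly 3: step across, then two steps back.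
  far : ∀ x → Dist G x (partner x) 3
  far x =
    let (k , k≢x , _) = avoid (idx x) (idx x)
    in step (toward (not (side x)) k (not-¬ refl) (≢-sym k≢x))
            (sameSideWalk (trans (side-vertex (not (side x)) k) (≡.sym (side-partner x)))) ,
       notWithinTwo (s ∘ ≡.sym) (≡.sym (idx-partner x))
    where
    s : side (partner x) ≢ side x
    s e = not-¬ refl (trans (≡.sym e) (side-partner x))

  connected : Connected G
  connected x y with y ≟ᶠ partner x
  ... | yes refl = 3 , proj₁ (far x)
  ... | no y≢x′  = let (j , _ , w) = near x y y≢x′ in j , w

  value : Bool → Fin 2 → ℕ
  value true  fzero    = 1
  value true  (fsuc _) = 2
  value false fzero    = 2
  value false (fsuc _) = 1

  value≥1 : ∀ c b → 1 ≤ value c b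
  value≥1 true  fzero    = s≤s z≤n
  value≥1 true  (fsuc _) = s≤s z≤n
  value≥1 false fzero    = s≤s z≤n
  value≥1 false (fsuc _) = s≤s z≤n

  value-complement : ∀ c b → value c b + value (not c) b ≡ 3
  value-complement true  fzero        = refl
  value-complement true  (fsuc fzero) = refl
  value-complement false fzero        = refl
  value-complement false (fsuc fzero) = refl

  value-injective : ∀ b b′ → value true b ≡ value true b′ → b ≡ b′
  value-injective fzero        fzero        _ = refl
  value-injective fzero        (fsuc fzero) ()
  value-injective (fsuc fzero) fzero        ()
  value-injective (fsuc fzero) (fsuc fzero) _ = refl

  hullVertex : (Fin m → Fin 2) → V → ℕ
  hullVertex s u = value (side u) (s (idx u))

  partnerSum : ∀ s x → hullVertex s x + hullVertex s (partner x) ≡ 3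
  partnerSum s x rewrite side-partner x | idx-partner x = value-complement (side x) (s (idx x))

  separate : ∀ s t k → s k ≢ t k → ∃[ x ] hullVertex s x ≢ hullVertex t x
  separate s t k s≢t = vertex true k , λ e → s≢t (value-injective _ _ (normalise e))
    where
    normalise : hullVertex s (vertex true k) ≡ hullVertex t (vertex true k) →
                value true (s k) ≡ value true (t k)
    normalise e rewrite side-vertex true k | idx-vertex true k = e

  hull : HullSizeAtLeast G (2 ^ m)
  hull = hullSizeFromCodes hullVertex
           (λ s → pairedHullVertex partner near far (hullVertex s)
                    (λ x → value≥1 (side x) (s (idx x))) (partnerSum s))
           separate

  witness : Witness G (2 ^ m)
  witness = connected , (side , proj₁) , noLongInducedCycle G side proj₁ almostComplete , hull

theorem8 : ∀ (m : ℕ) → 1 ≤ m →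
    Σ (Graph (m + m)) λ G →
      Connected G × Bipartite G × (∀ k → 6 < k → ¬ HasInducedCycle G k) ×
      HullSizeAtLeast G (2 ^ m ∸ 2)
theorem8 (suc zero)       _ = StarGraph.G 0 , witness-weaken z≤n (StarGraph.witness 0)
theorem8 (suc (suc zero)) _ = StarGraph.G 2 , StarGraph.witness 2
theorem8 m@(suc (suc (suc n))) _ =
  Crown.G m (avoidTwo n) , witness-weaken (m∸n≤m (2 ^ m) 2) (Crown.witness m (avoidTwo n))
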